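{- Let $\mathbf U=\langle\langle U,\approx\rangle,\preceq\rangle$ be a completely lattice $\mathbf L$-ordered set. The system of all complete binary $\mathbf L$-relations on $\mathbf U$ is an $\mathbf L$-closure system in the set $U\times U$, and hence (with the restrictions of $\approx^{U\times U}$ and $S$) a completely lattice $\mathbf L$-ordered set.
   Context: $\mathbf L=\langle L,\wedge,\vee,\otimes,\to,0,1\rangle$ is a complete residuated lattice ($\langle L,\wedge,\vee,0,1\rangle$ complete lattice, $\langle L,\otimes,1\rangle$ commutative monoid, $a\otimes b\le c$ iff $a\le b\to c$). An $\mathbf L$-set in $X$ is a map $X\to L$; $L^X$ the set of them; $S(A,B)=\bigwedge_x(A(x)\to B(x))$, $A\approx^X B=S(A,B)\wedge S(B,A)$. An $\mathbf L$-equality is a binary $\mathbf L$-relation that is reflexive, symmetric, transitive ($R(x,y)\otimes R(y,z)\le R(x,z)$) and with $R(x,y)=1\Rightarrow x=y$. An $\mathbf L$-ordered set is $\langle\langle U,\approx\rangle,\preceq\rangle$, $\approx$ an $\mathbf L$-equality, $\preceq$ reflexive, transitive, compatible with $\approx$ ($(u\preceq v)\otimes(u\approx u')\otimes(v\approx v')\le(u'\preceq v')$), and $(u\preceq v)\wedge(v\preceq u)\le u\approx v$. For $V\in L^U$: $\mathcal L V(v)=\bigwedge_u(V(u)\to(v\preceq u))$, $\mathcal U V(v)=\bigwedge_u(V(u)\to(u\preceq v))$; $\inf V$ is the unique $u$ with $\mathcal L V(u)=1=\mathcal U(\mathcal L V)(u)$, $\sup V$ the unique $u$ with $\mathcal U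 V(u)=1=\mathcal L(\mathcal U V)(u)$; completely lattice means these exist for all $V$. For a set $X$, $\langle\langle L^X,\approx^X\rangle,S\rangle$ is a completely lattice $\mathbf L$-ordered set with $(\inf \mathcal V)(x)=\bigwedge_{W\in L^X}(\mathcal V(W)\to W(x))$ for $\mathcal V\in L^{L^X}$; an $\mathbf L$-closure system in $X$ is a subset $M\subseteq L^X$ such that $\inf\mathcal V\in M$ for every $\mathbf L$-set $\mathcal V$ in $L^X$ with $\mathcal V(W)=0$ for $W\notin M$. Power relation: for $R$ on $X$ and $A,B\in L^X$, $(R\circ B)(x)=\bigvee_y R(x,y)\otimes B(y)$, $(A\circ R)(y)=\bigvee_x A(x)\otimes R(x,y)$, $R^+(A,B)=S(A,R\circ B)\wedge S(B,A\circ R)$. A binary $\mathbf L$-relation $R$ on $\mathbf U$ is complete if it is compatible with $\approx$ (i.e. $R(u,v)\otimes(u\approx u')\otimes(v\approx v')\le R(u',v')$) and for all $V_1,V_2\in L^U$, $R^+(V_1,V_2)\le R(\inf V_1,\inf V_2)$ and $R^+(V_1,V_2)\le R(\sup V_1,\sup V_2)$. -}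

module Defs where

open import Level using (0ℓ)
open import Data.Product using (Σ; _×_; _,_; proj₁; proj₂)
open import Relation.Nullary using (¬_)
open import Relation.Binary.PropositionalEquality using (_≡_)
open import Relation.Binary.Structures using (IsPartialOrder)
open import Algebra.Structures using (IsCommutativeMonoid)

-- A complete residuated lattice  L = ⟨L, ∧, ∨, ⊗, →, 0, 1⟩.
-- Equality on L is propositional equality; the lattice order is _≤_.
-- Arbitrary infima/suprema are indexed by arbitrary (small) types.
record CRL : Set₁ where
  infix 4 _≤_
  infixr 6 _⇒_
  infixl 7 _⊗_
  infixl 8 _∧_ _∨_
  field
    Carrier : Set
    _≤_ : Carrier → Carrier → Set
    ≤-isPartialOrder : IsPartialOrder _≡_ _≤_
    _∧_ _∨_ _⊗_ _⇒_ : Carrier → Carrier → Carrier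
    𝟘 𝟙 : Carrier
    ⋀ ⋁ : {I : Set} → (I → Carrier) → Carrier
    ⋀-lower : ∀ {I : Set} (f : I → Carrier) (i : I) → ⋀ f ≤ f i
    ⋀-greatest : ∀ {I : Set} (f : I → Carrier) (a : Carrier) → (∀ i → a ≤ f i) → a ≤ ⋀ f
    ⋁-upper : ∀ {I : Set} (f : I → Carrier) (i : I) → f i ≤ ⋁ f
    ⋁-least : ∀ {I : Set} (f : I → Carrier) (a : Carrier) → (∀ i → f i ≤ a) → ⋁ f ≤ a
    ∧-lowerˡ : ∀ a b → a ∧ b ≤ a
    ∧-lowerʳ : ∀ a b → a ∧ b ≤ b
    ∧-greatest : ∀ a b c → c ≤ a → c ≤ b → c ≤ a ∧ b
    ∨-upperˡ : ∀ a b → a ≤ a ∨ b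
    ∨-upperʳ : ∀ a b → b ≤ a ∨ b
    ∨-least : ∀ a b c → a ≤ c → b ≤ c → a ∨ b ≤ c
    𝟘-least : ∀ a → 𝟘 ≤ a
    𝟙-greatest : ∀ a → a ≤ 𝟙
    ⊗-isCommutativeMonoid : IsCommutativeMonoid _≡_ _⊗_ 𝟙
    adjoint⇒ : ∀ a b c → a ⊗ b ≤ c → a ≤ b ⇒ c
    adjoint⇐ : ∀ a b c → a ≤ b ⇒ c → a ⊗ b ≤ c

module Over (𝐋 : CRL) where
  open CRL 𝐋

  S : {X : Set} → (X → Carrier) → (X → Carrier) → Carrier
  S A B = ⋀ (λ x → A x ⇒ B x)

  _≈ˣ_ : {X : Set} → (X → Carrier) → (X → Carrier) → Carrier
  A ≈ˣ B = S A B ∧ S B A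

  -- L-equality on U; the condition "R(x,y)=1 ⇒ x=y" is stated w.r.t. a
  -- given (crisp) equality _≐_ on U (propositional equality for a plain set,
  -- pointwise equality for L-sets).
  record IsLEquality {U : Set} (_≐_ : U → U → Set) (E : U → U → Carrier) : Set where
    field
      E-refl : ∀ u → E u u ≡ 𝟙
      E-sym : ∀ u v → E u v ≡ E v u
      E-trans : ∀ u v w → E u v ⊗ E v w ≤ E u w
      E-sep : ∀ u v → E u v ≡ 𝟙 → u ≐ v

  record IsLOrdered {U : Set} (_≐_ : U → U → Set) (E P : U → U → Carrier) : Set where
    field
      isLEquality : IsLEquality _≐_ E
      P-refl : ∀ u → P u u ≡ 𝟙
      P-trans : ∀ u v w → P u v ⊗ P v w ≤ P u w
      P-compat : ∀ u v u' v' → P u v ⊗ E u u' ⊗ E v v' ≤ P u' v'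
      P-antisym : ∀ u v → P u v ∧ P v u ≤ E u v

  Lower : {U : Set} → (U → U → Carrier) → (U → Carrier) → (U → Carrier)
  Lower P V v = ⋀ (λ u → V u ⇒ P v u)

  Upper : {U : Set} → (U → U → Carrier) → (U → Carrier) → (U → Carrier)
  Upper P V v = ⋀ (λ u → V u ⇒ P u v)

  IsInf : {U : Set} → (U → U → Carrier) → (U → Carrier) → U → Set
  IsInf P V u = (Lower P V u ≡ 𝟙) × (Upper P (Lower P V) u ≡ 𝟙)

  IsSup : {U : Set} → (U → U → Carrier) → (U → Carrier) → U → Set
  IsSup P V u = (Upper P V u ≡ 𝟙) × (Lower P (Upper P V) u ≡ 𝟙)

  Unique∃ : {U : Set} → (U → U → Set) → (U → Set) → Set
  Unique∃ {U} _≐_ Q = Σ U (λ u → Q u × (∀ u' → Q u' → u' ≐ u))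

  IsCompletelyLattice : {U : Set} → (U → U → Set) → (U → U → Carrier) → Set
  IsCompletelyLattice {U} _≐_ P =
    ((V : U → Carrier) → Unique∃ _≐_ (IsInf P V)) ×
    ((V : U → Carrier) → Unique∃ _≐_ (IsSup P V))

  infOf : {U : Set} {_≐_ : U → U → Set} {P : U → U → Carrier} →
          IsCompletelyLattice _≐_ P → (U → Carrier) → U
  infOf cl V = proj₁ (proj₁ cl V)

  supOf : {U : Set} {_≐_ : U → U → Set} {P : U → U → Carrier} →
          IsCompletelyLattice _≐_ P → (U → Carrier) → U
  supOf cl V = proj₁ (proj₂ cl V)

  infLX : {X : Set} → ((X → Carrier) → Carrier) → (X → Carrier)
  infLX 𝒱 x = ⋀ (λ W → 𝒱 W ⇒ W x)

  IsLClosureSystem : {X : Set} → ((X → Carrier) → Set) → Set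
  IsLClosureSystem {X} M =
    (𝒱 : (X → Carrier) → Carrier) → (∀ W → ¬ M W → 𝒱 W ≡ 𝟘) → M (infLX 𝒱)

  _∘ᵣ_ : {X : Set} → (X × X → Carrier) → (X → Carrier) → (X → Carrier)
  (R ∘ᵣ B) x = ⋁ (λ y → R (x , y) ⊗ B y)

  _ᵣ∘_ : {X : Set} → (X → Carrier) → (X × X → Carrier) → (X → Carrier)
  (A ᵣ∘ R) y = ⋁ (λ x → A x ⊗ R (x , y))

  _⁺ : {X : Set} → (X × X → Carrier) → (X → Carrier) → (X → Carrier) → Carrier
  (R ⁺) A B = S A (R ∘ᵣ B) ∧ S B (A ᵣ∘ R)

  record IsCompleteRel {U : Set} {_≐_ : U → U → Set} (E P : U → U → Carrier)
                       (cl : IsCompletelyLattice _≐_ P) (R : U × U → Carrier) : Set where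
    field
      compat : ∀ u v u' v' → R (u , v) ⊗ E u u' ⊗ E v v' ≤ R (u' , v')
      inf-pres : ∀ (V₁ V₂ : U → Carrier) → (R ⁺) V₁ V₂ ≤ R (infOf cl V₁ , infOf cl V₂)
      sup-pres : ∀ (V₁ V₂ : U → Carrier) → (R ⁺) V₁ V₂ ≤ R (supOf cl V₁ , supOf cl V₂)

  Sub : {X : Set} → ((X → Carrier) → Set) → Set
  Sub {X} M = Σ (X → Carrier) M

  _≐Sub_ : {X : Set} {M : (X → Carrier) → Set} → Sub M → Sub M → Set
  A ≐Sub B = ∀ x → proj₁ A x ≡ proj₁ B x

  ≈Sub : {X : Set} {M : (X → Carrier) → Set} → Sub M → Sub M → Carrier
  ≈Sub A B = proj₁ A ≈ˣ proj₁ B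

  SSub : {X : Set} {M : (X → Carrier) → Set} → Sub M → Sub M → Carrier
  SSub A B = S (proj₁ A) (proj₁ B)

-- Each condition defining completeness of R has the form c(R) ≤ R q with c
-- built from R by ⊗, ⋁, ∧ and S; since 𝒱 W ⊗ (inf 𝒱) ≤ W pointwise, also
-- 𝒱 W ⊗ c(inf 𝒱) ≤ c(W). For complete W this gives 𝒱 W ⊗ c(inf 𝒱) ≤ W q,
-- and meeting over W yields the condition for inf 𝒱.
-- An L-closure system is closed under the infima of ⟨L^X, S⟩, hence has all
-- infima, and an L-ordered set with all infima is completely lattice: sup V
-- is the infimum of the upper cone of V.
module Submission where

open import Defs
open import Level using (0ℓ)
open import Data.Product using (Σ; _×_; _,_; proj₁)
open import Data.Empty using (⊥-elim)
open import Relation.Nullary using (¬_; yes; no)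
open import Relation.Binary.PropositionalEquality using (_≡_; sym; cong)
open import Relation.Binary.Bundles using (Poset)
open import Relation.Binary.Structures using (IsPartialOrder)
open import Algebra.Bundles using (CommutativeSemigroup)
open import Algebra.Structures using (IsCommutativeMonoid)
import Algebra.Properties.CommutativeSemigroup as CommutativeSemigroupProperties
import Relation.Binary.Reasoning.PartialOrder as PosetReasoning
open import Axiom.ExcludedMiddle using (ExcludedMiddle)

module Properties (𝐋 : CRL) where
  open CRL 𝐋
  open Over 𝐋
  open IsPartialOrder ≤-isPartialOrder
    using () renaming (refl to ≤-refl; reflexive to ≤-reflexive; trans to ≤-trans; antisym to ≤-antisym)
  open IsCommutativeMonoid ⊗-isCommutativeMonoid
    using (isCommutativeSemigroup) renaming (comm to ⊗-comm; assoc to ⊗-assoc; identityˡ to ⊗-identityˡ)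

  ⊗-commutativeSemigroup : CommutativeSemigroup 0ℓ 0ℓ
  ⊗-commutativeSemigroup = record { isCommutativeSemigroup = isCommutativeSemigroup }

  open CommutativeSemigroupProperties ⊗-commutativeSemigroup using (xy∙z≈xz∙y)

  poset : Poset 0ℓ 0ℓ 0ℓ
  poset = record { isPartialOrder = ≤-isPartialOrder }

  open PosetReasoning poset

  ⇒-eval : ∀ a b → (a ⇒ b) ⊗ a ≤ b
  ⇒-eval a b = adjoint⇐ _ _ _ ≤-refl

  ⊗-monoˡ : ∀ {a b} c → a ≤ b → a ⊗ c ≤ b ⊗ c
  ⊗-monoˡ c a≤b = adjoint⇐ _ _ _ (≤-trans a≤b (adjoint⇒ _ _ _ ≤-refl))

  ⊗-monoʳ : ∀ {a b} c → a ≤ b → c ⊗ a ≤ c ⊗ b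
  ⊗-monoʳ {a} {b} c a≤b = begin
    c ⊗ a  ≡⟨ ⊗-comm c a ⟩
    a ⊗ c  ≤⟨ ⊗-monoˡ c a≤b ⟩
    b ⊗ c  ≡⟨ ⊗-comm b c ⟩
    c ⊗ b  ∎

  ⊗-mono : ∀ {a b c d} → a ≤ b → c ≤ d → a ⊗ c ≤ b ⊗ d
  ⊗-mono {b = b} {c = c} a≤b c≤d = ≤-trans (⊗-monoˡ c a≤b) (⊗-monoʳ b c≤d)

  𝟘⊗-least : ∀ a b → 𝟘 ⊗ a ≤ b
  𝟘⊗-least a b = adjoint⇐ _ _ _ (𝟘-least _)

  ⊗-distribˡ-⋁ : ∀ {I : Set} c (f : I → Carrier) → c ⊗ ⋁ f ≤ ⋁ (λ i → c ⊗ f i)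
  ⊗-distribˡ-⋁ c f = begin
    c ⊗ ⋁ f                ≡⟨ ⊗-comm c (⋁ f) ⟩
    ⋁ f ⊗ c                ≤⟨ adjoint⇐ _ _ _ (⋁-least _ _ λ i → adjoint⇒ _ _ _ (begin
                                f i ⊗ c                ≡⟨ ⊗-comm (f i) c ⟩
                                c ⊗ f i                ≤⟨ ⋁-upper (λ j → c ⊗ f j) i ⟩
                                ⋁ (λ j → c ⊗ f j)      ∎)) ⟩
    ⋁ (λ i → c ⊗ f i)      ∎

  𝟙≤⇒≡𝟙 : ∀ {a} → 𝟙 ≤ a → a ≡ 𝟙
  𝟙≤⇒≡𝟙 = ≤-antisym (𝟙-greatest _)

  ≤⇒𝟙≤⇒ : ∀ {a b} → a ≤ b → 𝟙 ≤ a ⇒ b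
  ≤⇒𝟙≤⇒ a≤b = adjoint⇒ _ _ _ (≤-trans (≤-reflexive (⊗-identityˡ _)) a≤b)

  𝟙≤⇒⇒≤ : ∀ {a b} → 𝟙 ≤ a ⇒ b → a ≤ b
  𝟙≤⇒⇒≤ 𝟙≤a⇒b = ≤-trans (≤-reflexive (sym (⊗-identityˡ _))) (adjoint⇐ _ _ _ 𝟙≤a⇒b)

  ⋀⇒≡𝟙-intro : ∀ {I : Set} (g h : I → Carrier) → (∀ i → g i ≤ h i) → ⋀ (λ i → g i ⇒ h i) ≡ 𝟙
  ⋀⇒≡𝟙-intro g h g≤h = 𝟙≤⇒≡𝟙 (⋀-greatest _ _ λ i → ≤⇒𝟙≤⇒ (g≤h i))

  ⋀⇒≡𝟙-elim : ∀ {I : Set} (g h : I → Carrier) → ⋀ (λ i → g i ⇒ h i) ≡ 𝟙 → ∀ i → g i ≤ h i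
  ⋀⇒≡𝟙-elim g h eq i = 𝟙≤⇒⇒≤ (≤-trans (≤-reflexive (sym eq)) (⋀-lower _ i))

  module _ {X : Set} where

    S-apply : ∀ (A B : X → Carrier) x → S A B ⊗ A x ≤ B x
    S-apply A B x = ≤-trans (⊗-monoˡ _ (⋀-lower _ x)) (⇒-eval _ _)

    S-intro : ∀ c (A B : X → Carrier) → (∀ x → c ⊗ A x ≤ B x) → c ≤ S A B
    S-intro c A B c⊗A≤B = ⋀-greatest _ _ λ x → adjoint⇒ _ _ _ (c⊗A≤B x)

    S-mapʳ : ∀ a (A B C : X → Carrier) → (∀ x → a ⊗ B x ≤ C x) → a ⊗ S A B ≤ S A C
    S-mapʳ a A B C a⊗B≤C = S-intro _ A C λ x → begin
      a ⊗ S A B ⊗ A x      ≡⟨ ⊗-assoc a _ _ ⟩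
      a ⊗ (S A B ⊗ A x)    ≤⟨ ⊗-monoʳ a (S-apply A B x) ⟩
      a ⊗ B x              ≤⟨ a⊗B≤C x ⟩
      C x                  ∎

    S-refl : ∀ (A : X → Carrier) → S A A ≡ 𝟙
    S-refl A = ⋀⇒≡𝟙-intro A A λ _ → ≤-refl

    S-trans : ∀ (A B C : X → Carrier) → S A B ⊗ S B C ≤ S A C
    S-trans A B C = S-intro _ A C λ x → begin
      S A B ⊗ S B C ⊗ A x      ≡⟨ xy∙z≈xz∙y _ _ _ ⟩
      S A B ⊗ A x ⊗ S B C      ≤⟨ ⊗-monoˡ _ (S-apply A B x) ⟩
      B x ⊗ S B C              ≡⟨ ⊗-comm _ _ ⟩
      S B C ⊗ B x              ≤⟨ S-apply B C x ⟩
      C x                      ∎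

    infLX-lower : ∀ (𝒱 : (X → Carrier) → Carrier) W x → 𝒱 W ⊗ infLX 𝒱 x ≤ W x
    infLX-lower 𝒱 W x = begin
      𝒱 W ⊗ infLX 𝒱 x          ≡⟨ ⊗-comm _ _ ⟩
      infLX 𝒱 x ⊗ 𝒱 W          ≤⟨ ⊗-monoˡ _ (⋀-lower (λ W' → 𝒱 W' ⇒ W' x) W) ⟩
      (𝒱 W ⇒ W x) ⊗ 𝒱 W        ≤⟨ ⇒-eval _ _ ⟩
      W x                      ∎

    infLX-greatest : ∀ (𝒱 : (X → Carrier) → Carrier) c x →
                     (∀ W → 𝒱 W ⊗ c ≤ W x) → c ≤ infLX 𝒱 x
    infLX-greatest 𝒱 c x 𝒱⊗c≤W = ⋀-greatest _ _ λ W →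
      adjoint⇒ _ _ _ (≤-trans (≤-reflexive (⊗-comm c _)) (𝒱⊗c≤W W))

    -- The L-sets W outside M contribute nothing since 𝒱 W = 𝟘, but deciding
    -- M W to discard them needs excluded middle.
    infLX-greatest-on : ExcludedMiddle 0ℓ → ∀ (M : (X → Carrier) → Set) (𝒱 : (X → Carrier) → Carrier) →
                        (∀ W → ¬ M W → 𝒱 W ≡ 𝟘) → ∀ c x →
                        (∀ W → M W → 𝒱 W ⊗ c ≤ W x) → c ≤ infLX 𝒱 x
    infLX-greatest-on em M 𝒱 𝒱-support c x bound = infLX-greatest 𝒱 c x bound′
      where
        bound′ : ∀ W → 𝒱 W ⊗ c ≤ W x
        bound′ W with em {M W}
        ... | yes W∈M = bound W W∈M
        ... | no W∉M  = ≤-trans (≤-reflexive (cong (_⊗ c) (𝒱-support W W∉M))) (𝟘⊗-least c (W x))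

  module _ {X : Set} (a : Carrier) (R T : X × X → Carrier) (a⊗R≤T : ∀ q → a ⊗ R q ≤ T q) where

    ∘ᵣ-mono : ∀ (B : X → Carrier) x → a ⊗ (R ∘ᵣ B) x ≤ (T ∘ᵣ B) x
    ∘ᵣ-mono B x = ≤-trans (⊗-distribˡ-⋁ a _) (⋁-least _ _ λ y → begin
      a ⊗ (R (x , y) ⊗ B y)    ≡⟨ sym (⊗-assoc a _ _) ⟩
      a ⊗ R (x , y) ⊗ B y      ≤⟨ ⊗-monoˡ (B y) (a⊗R≤T (x , y)) ⟩
      T (x , y) ⊗ B y          ≤⟨ ⋁-upper (λ y′ → T (x , y′) ⊗ B y′) y ⟩
      (T ∘ᵣ B) x               ∎)

    ᵣ∘-mono : ∀ (A : X → Carrier) y → a ⊗ (A ᵣ∘ R) y ≤ (A ᵣ∘ T) y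
    ᵣ∘-mono A y = ≤-trans (⊗-distribˡ-⋁ a _) (⋁-least _ _ λ x → begin
      a ⊗ (A x ⊗ R (x , y))    ≡⟨ sym (⊗-assoc a _ _) ⟩
      a ⊗ A x ⊗ R (x , y)      ≡⟨ cong (_⊗ R (x , y)) (⊗-comm a (A x)) ⟩
      A x ⊗ a ⊗ R (x , y)      ≡⟨ ⊗-assoc _ _ _ ⟩
      A x ⊗ (a ⊗ R (x , y))    ≤⟨ ⊗-monoʳ (A x) (a⊗R≤T (x , y)) ⟩
      A x ⊗ T (x , y)          ≤⟨ ⋁-upper (λ x′ → A x′ ⊗ T (x′ , y)) x ⟩
      (A ᵣ∘ T) y               ∎)

    ⁺-mono : ∀ (A B : X → Carrier) → a ⊗ (R ⁺) A B ≤ (T ⁺) A B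
    ⁺-mono A B = ∧-greatest _ _ _
      (≤-trans (⊗-monoʳ a (∧-lowerˡ _ _)) (S-mapʳ a A _ _ (∘ᵣ-mono B)))
      (≤-trans (⊗-monoʳ a (∧-lowerʳ _ _)) (S-mapʳ a B _ _ (ᵣ∘-mono A)))

  completeRel-isLClosureSystem : ExcludedMiddle 0ℓ → {U : Set} (E P : U → U → Carrier)
    (cl : IsCompletelyLattice _≡_ P) → IsLClosureSystem (IsCompleteRel E P cl)
  completeRel-isLClosureSystem em {U} E P cl 𝒱 𝒱-support = record
    { compat   = λ u v u′ v′ → meet-bound _ (u′ , v′) λ W W-complete → begin
        𝒱 W ⊗ (R (u , v) ⊗ E u u′ ⊗ E v v′)    ≡⟨ sym (⊗-assoc _ _ _) ⟩
        𝒱 W ⊗ (R (u , v) ⊗ E u u′) ⊗ E v v′    ≡⟨ cong (_⊗ E v v′) (sym (⊗-assoc _ _ _)) ⟩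
        𝒱 W ⊗ R (u , v) ⊗ E u u′ ⊗ E v v′      ≤⟨ ⊗-monoˡ _ (⊗-monoˡ _ (infLX-lower 𝒱 W (u , v))) ⟩
        W (u , v) ⊗ E u u′ ⊗ E v v′            ≤⟨ IsCompleteRel.compat W-complete u v u′ v′ ⟩
        W (u′ , v′)                            ∎
    ; inf-pres = λ V₁ V₂ → meet-bound _ _ λ W W-complete →
        ≤-trans (⁺-mono (𝒱 W) R W (infLX-lower 𝒱 W) V₁ V₂) (IsCompleteRel.inf-pres W-complete V₁ V₂)
    ; sup-pres = λ V₁ V₂ → meet-bound _ _ λ W W-complete →
        ≤-trans (⁺-mono (𝒱 W) R W (infLX-lower 𝒱 W) V₁ V₂) (IsCompleteRel.sup-pres W-complete V₁ V₂)
    }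
    where
      R : U × U → Carrier
      R = infLX 𝒱

      meet-bound : ∀ c q → (∀ W → IsCompleteRel E P cl W → 𝒱 W ⊗ c ≤ W q) → c ≤ R q
      meet-bound = infLX-greatest-on em (IsCompleteRel E P cl) 𝒱 𝒱-support

  Sub-isLOrdered : {X : Set} (M : (X → Carrier) → Set) → IsLOrdered (_≐Sub_ {M = M}) ≈Sub SSub
  Sub-isLOrdered M = record
    { isLEquality = record
      { E-refl  = λ (A , _) → 𝟙≤⇒≡𝟙 (∧-greatest _ _ _ (≤-reflexive (sym (S-refl A))) (≤-reflexive (sym (S-refl A))))
      ; E-sym   = λ _ _ → ≤-antisym ∧-swap ∧-swap
      ; E-trans = λ (A , _) (B , _) (C , _) → ∧-greatest _ _ _
          (≤-trans (⊗-mono (∧-lowerˡ _ _) (∧-lowerˡ _ _)) (S-trans A B C))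
          (≤-trans (≤-reflexive (⊗-comm _ _)) (≤-trans (⊗-mono (∧-lowerʳ _ _) (∧-lowerʳ _ _)) (S-trans C B A)))
      ; E-sep   = λ (A , _) (B , _) A≈B≡𝟙 x → ≤-antisym
          (⋀⇒≡𝟙-elim A B (𝟙≤⇒≡𝟙 (≤-trans (≤-reflexive (sym A≈B≡𝟙)) (∧-lowerˡ _ _))) x)
          (⋀⇒≡𝟙-elim B A (𝟙≤⇒≡𝟙 (≤-trans (≤-reflexive (sym A≈B≡𝟙)) (∧-lowerʳ _ _))) x)
      }
    ; P-refl    = λ (A , _) → S-refl A
    ; P-trans   = λ (A , _) (B , _) (C , _) → S-trans A B C
    ; P-compat  = λ (A , _) (B , _) (A′ , _) (B′ , _) → begin
        S A B ⊗ (A ≈ˣ A′) ⊗ (B ≈ˣ B′)        ≤⟨ ⊗-mono (⊗-monoʳ _ (∧-lowerʳ _ _)) (∧-lowerˡ _ _) ⟩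
        S A B ⊗ S A′ A ⊗ S B B′              ≤⟨ ⊗-monoˡ _ (≤-trans (≤-reflexive (⊗-comm _ _)) (S-trans A′ A B)) ⟩
        S A′ B ⊗ S B B′                      ≤⟨ S-trans A′ B B′ ⟩
        S A′ B′                              ∎
    ; P-antisym = λ _ _ → ≤-refl
    }
    where
      ∧-swap : ∀ {a b} → a ∧ b ≤ b ∧ a
      ∧-swap = ∧-greatest _ _ _ (∧-lowerʳ _ _) (∧-lowerˡ _ _)

  -- The infimum of 𝒱 in M is its infimum in L^X after transporting 𝒱 to
  -- L^X, where an L-set W gets the join of 𝒱 over all proofs of M W.
  Sub-inf : {X : Set} (M : (X → Carrier) → Set) → IsLClosureSystem M →
            (𝒱 : Sub M → Carrier) → Σ (Sub M) (IsInf SSub 𝒱)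
  Sub-inf {X} M closed 𝒱 = I , I-lower , I-greatest
    where
      𝒱ˣ : (X → Carrier) → Carrier
      𝒱ˣ W = ⋁ {I = M W} λ W∈M → 𝒱 (W , W∈M)

      𝒱ˣ-support : ∀ W → ¬ M W → 𝒱ˣ W ≡ 𝟘
      𝒱ˣ-support W W∉M = ≤-antisym (⋁-least _ _ λ W∈M → ⊥-elim (W∉M W∈M)) (𝟘-least _)

      I : Sub M
      I = infLX 𝒱ˣ , closed 𝒱ˣ 𝒱ˣ-support

      𝒱≤𝒱ˣ : ∀ W W∈M → 𝒱 (W , W∈M) ≤ 𝒱ˣ W
      𝒱≤𝒱ˣ W W∈M = ⋁-upper (λ W∈M′ → 𝒱 (W , W∈M′)) W∈M

      I-lower : Lower SSub 𝒱 I ≡ 𝟙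
      I-lower = ⋀⇒≡𝟙-intro 𝒱 (SSub I) λ (W , W∈M) → S-intro _ (proj₁ I) W λ x → begin
        𝒱 (W , W∈M) ⊗ infLX 𝒱ˣ x    ≤⟨ ⊗-monoˡ _ (𝒱≤𝒱ˣ W W∈M) ⟩
        𝒱ˣ W ⊗ infLX 𝒱ˣ x           ≤⟨ infLX-lower 𝒱ˣ W x ⟩
        W x                          ∎

      lower-bound≤I : ∀ B x W → Lower SSub 𝒱 B ⊗ proj₁ B x ⊗ 𝒱ˣ W ≤ W x
      lower-bound≤I B x W = ≤-trans (⊗-distribˡ-⋁ _ _) (⋁-least _ _ λ W∈M → begin
        Lower SSub 𝒱 B ⊗ proj₁ B x ⊗ 𝒱 (W , W∈M)    ≡⟨ xy∙z≈xz∙y _ _ _ ⟩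
        Lower SSub 𝒱 B ⊗ 𝒱 (W , W∈M) ⊗ proj₁ B x    ≤⟨ ⊗-monoˡ _ (adjoint⇐ _ _ _ (⋀-lower (λ C → 𝒱 C ⇒ SSub B C) (W , W∈M))) ⟩
        S (proj₁ B) W ⊗ proj₁ B x                    ≤⟨ S-apply (proj₁ B) W x ⟩
        W x                                          ∎)

      I-greatest : Upper SSub (Lower SSub 𝒱) I ≡ 𝟙
      I-greatest = ⋀⇒≡𝟙-intro (Lower SSub 𝒱) (λ B → SSub B I) λ B →
        S-intro _ (proj₁ B) (proj₁ I) λ x → ⋀-greatest _ _ λ W → adjoint⇒ _ _ _ (lower-bound≤I B x W)

  module _ {U : Set} {_≐_ : U → U → Set} {E P : U → U → Carrier} (ordered : IsLOrdered _≐_ E P) where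
    open IsLOrdered ordered
    open IsLEquality isLEquality

    ≐-from-𝟙≤ : ∀ u u′ → 𝟙 ≤ P u′ u → 𝟙 ≤ P u u′ → u′ ≐ u
    ≐-from-𝟙≤ u u′ u′≤u u≤u′ = E-sep u′ u (𝟙≤⇒≡𝟙 (≤-trans (∧-greatest _ _ _ u′≤u u≤u′) (P-antisym u′ u)))

    IsInf-unique : ∀ V u u′ → IsInf P V u → IsInf P V u′ → u′ ≐ u
    IsInf-unique V u u′ (u-lower , u-greatest) (u′-lower , u′-greatest) = ≐-from-𝟙≤ u u′
      (≤-trans (≤-reflexive (sym u′-lower)) (⋀⇒≡𝟙-elim (Lower P V) (λ w → P w u) u-greatest u′))
      (≤-trans (≤-reflexive (sym u-lower)) (⋀⇒≡𝟙-elim (Lower P V) (λ w → P w u′) u′-greatest u))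

    IsSup-unique : ∀ V u u′ → IsSup P V u → IsSup P V u′ → u′ ≐ u
    IsSup-unique V u u′ (u-upper , u-least) (u′-upper , u′-least) = ≐-from-𝟙≤ u u′
      (≤-trans (≤-reflexive (sym u-upper)) (⋀⇒≡𝟙-elim (Upper P V) (λ w → P u′ w) u′-least u))
      (≤-trans (≤-reflexive (sym u′-upper)) (⋀⇒≡𝟙-elim (Upper P V) (λ w → P u w) u-least u′))

    ⊆-Lower-Upper : ∀ V v → V v ≤ Lower P (Upper P V) v
    ⊆-Lower-Upper V v = ⋀-greatest _ _ λ w → adjoint⇒ _ _ _ (begin
      V v ⊗ Upper P V w          ≡⟨ ⊗-comm _ _ ⟩
      Upper P V w ⊗ V v          ≤⟨ ⊗-monoˡ _ (⋀-lower (λ u → V u ⇒ P u w) v) ⟩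
      (V v ⇒ P v w) ⊗ V v        ≤⟨ ⇒-eval _ _ ⟩
      P v w                      ∎)

    inf-Upper⇒IsSup : ∀ V u → IsInf P (Upper P V) u → IsSup P V u
    inf-Upper⇒IsSup V u (u-lower , u-greatest) =
      ⋀⇒≡𝟙-intro V (λ v → P v u) (λ v →
        ≤-trans (⊆-Lower-Upper V v) (⋀⇒≡𝟙-elim (Lower P (Upper P V)) (λ w → P w u) u-greatest v))
      , u-lower

    infima⇒IsCompletelyLattice : ((V : U → Carrier) → Σ U (IsInf P V)) → IsCompletelyLattice _≐_ P
    infima⇒IsCompletelyLattice inf =
      (λ V → let (u , u-inf) = inf V in
               u , u-inf , λ u′ → IsInf-unique V u u′ u-inf) ,
      (λ V → let (u , u-inf) = inf (Upper P V) ; u-sup = inf-Upper⇒IsSup V u u-inf in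
               u , u-sup , λ u′ → IsSup-unique V u u′ u-sup)

theorem8 : (𝐋 : CRL) → ExcludedMiddle 0ℓ →
    let open CRL 𝐋 in let open Over 𝐋 in
    (U : Set) (E P : U → U → Carrier) →
    IsLOrdered _≡_ E P →
    (cl : IsCompletelyLattice _≡_ P) →
    IsLClosureSystem (IsCompleteRel E P cl)
    × IsLOrdered (_≐Sub_ {M = IsCompleteRel E P cl}) ≈Sub SSub
    × IsCompletelyLattice (_≐Sub_ {M = IsCompleteRel E P cl}) SSub
theorem8 𝐋 em U E P _ cl =
  closed , Sub-isLOrdered M , infima⇒IsCompletelyLattice (Sub-isLOrdered M) (Sub-inf M closed)
  where
    open CRL 𝐋
    open Over 𝐋
    open Properties 𝐋

    M : (U × U → Carrier) → Set
    M = IsCompleteRel E P cl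

    closed : IsLClosureSystem M
    closed = completeRel-isLClosureSystem em E P cl
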